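{- Let $G$ be a finite nontrivial abelian group and let $S$ be a sequence over $G$. (i) If $|S|\ge\log_2|G|+1$ and $G$ is not an elementary abelian $2$-group, then $S$ contains a proper, nonempty $\{\pm1\}$-weighted zero-sum subsequence. (ii) If $|S|\ge\log_2|G|+2$ and $G$ is not an elementary abelian $2$-group of even rank, then $S$ contains a proper, nonempty $\{\pm1\}$-weighted zero-sum subsequence of even length. (iii) If $|S|>\log_2|G|$, then $S$ contains a nonempty $\{\pm1\}$-weighted zero-sum subsequence, and if $|S|>\log_2|G|+1$, then such a subsequence may be found with even length.
   Context: A sequence over $G$ is a finite (unordered) list of elements of $G$, repetitions allowed; $|S|$ is its length (number of terms). A subsequence is a sublist; it is proper if it is not all of $S$. A sequence $g_1,\ldots,g_n$ is a $\{\pm1\}$-weighted zero-sum sequence if there exist $\varepsilon_1,\ldots,\varepsilon_n\in\{1,-1\}$ with $\sum_{i=1}^n\varepsilon_ig_i=0$. An elementary abelian $2$-group is one isomorphic to $\mathbb Z_2^k$ for some $k$, and its rank is $k$. -}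

module Defs where

open import Level using (Level; _⊔_)
open import Algebra.Bundles using (AbelianGroup)
open import Data.Nat using (ℕ; _<_; _≤_; suc; _+_)
open import Data.Nat.Divisibility using (_∣_)
open import Data.Nat.Logarithm using (⌊log₂_⌋; ⌈log₂_⌉)
open import Data.Fin using (Fin)
open import Data.Bool using (Bool; _xor_)
open import Data.Vec using (Vec; []; _∷_; zipWith)
open import Data.List using (List; []; _∷_; length)
open import Data.List.Relation.Binary.Sublist.Propositional using (_⊆_)
open import Data.Sign using (Sign)
open import Data.Product using (Σ; ∃; _×_)
open import Relation.Binary.PropositionalEquality using (_≡_)
open import Relation.Nullary using (¬_)

module _ {c ℓ : Level} (G : AbelianGroup c ℓ) where
  open AbelianGroup G

  record HasOrder (n : ℕ) : Set (c ⊔ ℓ) where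
    field
      enum       : Fin n → Carrier
      enum-inj   : ∀ i j → enum i ≈ enum j → i ≡ j
      enum-surj  : ∀ x → ∃ λ i → enum i ≈ x

  -- A group isomorphism Z₂^k ≅ G, with Z₂^k = Vec Bool k under pointwise xor.
  record Z₂^-Iso (k : ℕ) : Set (c ⊔ ℓ) where
    field
      φ      : Vec Bool k → Carrier
      φ-hom  : ∀ u v → φ (zipWith _xor_ u v) ≈ φ u ∙ φ v
      φ-inj  : ∀ u v → φ u ≈ φ v → u ≡ v
      φ-surj : ∀ x → ∃ λ u → φ u ≈ x

  IsElemAb2 : Set (c ⊔ ℓ)
  IsElemAb2 = ∃ λ k → Z₂^-Iso k

  IsElemAb2EvenRank : Set (c ⊔ ℓ)
  IsElemAb2EvenRank = ∃ λ k → 2 ∣ k × Z₂^-Iso k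

  signed : Sign → Carrier → Carrier
  signed Sign.+ g = g
  signed Sign.- g = g ⁻¹

  weightedSum : (T : List Carrier) → Vec Sign (length T) → Carrier
  weightedSum [] [] = ε
  weightedSum (g ∷ T) (s ∷ ss) = signed s g ∙ weightedSum T ss

  PMZeroSum : List Carrier → Set ℓ
  PMZeroSum T = ∃ λ (w : Vec Sign (length T)) → weightedSum T w ≈ ε

  HasNonemptyPMZS : List Carrier → Set (c ⊔ ℓ)
  HasNonemptyPMZS S = ∃ λ T → T ⊆ S × 0 < length T × PMZeroSum T

  HasNonemptyEvenPMZS : List Carrier → Set (c ⊔ ℓ)
  HasNonemptyEvenPMZS S = ∃ λ T → T ⊆ S × 0 < length T × 2 ∣ length T × PMZeroSum T

  HasProperNonemptyPMZS : List Carrier → Set (c ⊔ ℓ)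
  HasProperNonemptyPMZS S =
    ∃ λ T → T ⊆ S × 0 < length T × length T < length S × PMZeroSum T

  HasProperNonemptyEvenPMZS : List Carrier → Set (c ⊔ ℓ)
  HasProperNonemptyEvenPMZS S =
    ∃ λ T → T ⊆ S × 0 < length T × length T < length S × 2 ∣ length T × PMZeroSum T

-- Subset sums of k terms form a map Z₂^k → G. When n ≤ 2^k it either has a collision, and the
-- difference of two colliding subsets is a nonempty ±1-weighted zero sum, or it is a bijection;
-- when n < 2^k it must collide, which gives (iii).
--
-- For (i) write S = y₀ … y_k with n ≤ 2^k. Unless a proper zero sum appears, for every p the
-- subset sums of the other k terms are bijective and the subset representing y_p must be all of
-- them (a smaller one cancels y_p properly), so 2y_p = ΣS for every p. Representing ΣS by a subset
-- of y₁ … y_k then either cancels some y_q properly or forces ΣS = 0, in which case every y_q has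
-- order at most 2 and the subset sums of y₁ … y_k are an isomorphism Z₂^k ≅ G.
--
-- (ii) and the even half of (iii) run the same argument on the subsets of fixed parity of k + 1
-- terms, which are again indexed by Z₂^k: two subsets of equal parity differ by an even number of
-- terms, and in (ii) the k + 1 terms other than y_p must form an odd set, so the rank k is even.

module Submission where

open import Defs
open import Level using (Level; _⊔_)
open import Algebra.Bundles using (AbelianGroup; CommutativeRing)
open import Data.Bool using (Bool; true; false; not; _xor_)
import Data.Bool as Bool
open import Data.Bool.Properties using (xor-∧-commutativeRing; not-injective; xor-same)
open import Data.Empty using (⊥-elim)
open import Data.Fin using (Fin; zero; suc; _≟_; punchOut; combine; remQuot)
open import Data.Fin.Properties
  using (any?; punchOut-injective; <⇒notInjective; combine-remQuot; remQuot-combine; 2↔Bool; sequence)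
open import Data.List using (List; []; _∷_; length)
open import Data.List.Relation.Binary.Sublist.Propositional using (_⊆_; []; _∷_; _∷ʳ_)
open import Data.Maybe using (Maybe; just; nothing; is-just)
open import Data.Nat using (ℕ; zero; suc; _<_; _≤_; _+_; _*_; _^_; z≤n; s≤s; ⌊_/2⌋; ⌈_/2⌉)
open import Data.Nat.Divisibility using (_∣_; divides; ∣m∣n⇒∣m+n; ∣m+n∣m⇒∣n; ∣-refl)
open import Data.Nat.Induction using (<-wellFounded)
open import Data.Nat.Logarithm using (⌊log₂_⌋; ⌈log₂_⌉)
open import Data.Nat.Logarithm.Core using (⌊log2⌋; ⌈log2⌉)
open import Data.Nat.Properties
  using (≤-refl; ≤-trans; ≤-reflexive; m≤n⇒m≤1+n; *-suc; *-monoʳ-≤; ^-monoʳ-≤; <-≤-trans)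
open import Data.Product using (∃; ∃₂; _×_; _,_; proj₁; proj₂)
open import Data.Sign using (Sign)
open import Data.Sum using (_⊎_; inj₁; inj₂; [_,_]′; map₁)
import Data.Sum.Effectful.Left as Sumₗ
open import Data.Vec using (Vec; []; _∷_; replicate; insertAt; removeAt; lookup; zipWith; map; fromList)
open import Data.Vec.Properties using (≡-dec; insertAt-removeAt; map-insertAt)
open import Function using (Inverse; _∘_; id)
open import Function.Definitions using (Injective)
open import Induction.WellFounded using (Acc; acc)
open import Relation.Nullary using (yes; no; ¬_; contradiction)
open import Relation.Nullary.Decidable using (¬?; _×-dec_; decidable-stable)
open import Relation.Binary.PropositionalEquality as ≡ using (_≡_; _≢_; refl; cong; cong₂; subst)
open import Algebra.Properties.CommutativeSemigroup
  (CommutativeRing.+-commutativeSemigroup xor-∧-commutativeRing)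
  using () renaming (interchange to xor-interchange)

n≤2*⌈n/2⌉ : ∀ n → n ≤ 2 * ⌈ n /2⌉
n≤2*⌈n/2⌉ 0 = z≤n
n≤2*⌈n/2⌉ 1 = s≤s z≤n
n≤2*⌈n/2⌉ (suc (suc n)) =
  ≤-trans (s≤s (s≤s (n≤2*⌈n/2⌉ n))) (≤-reflexive (≡.sym (*-suc 2 ⌈ n /2⌉)))

n<2*suc⌊n/2⌋ : ∀ n → n < 2 * suc ⌊ n /2⌋
n<2*suc⌊n/2⌋ 0 = s≤s z≤n
n<2*suc⌊n/2⌋ 1 = s≤s (s≤s z≤n)
n<2*suc⌊n/2⌋ (suc (suc n)) =
  ≤-trans (s≤s (s≤s (n<2*suc⌊n/2⌋ n))) (≤-reflexive (≡.sym (*-suc 2 (suc ⌊ n /2⌋))))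

n≤2^⌈log2⌉n : ∀ n (rec : Acc _<_ n) → n ≤ 2 ^ ⌈log2⌉ n rec
n≤2^⌈log2⌉n 0 _ = z≤n
n≤2^⌈log2⌉n 1 _ = ≤-refl
n≤2^⌈log2⌉n (suc (suc n)) (acc rs) =
  ≤-trans (n≤2*⌈n/2⌉ (suc (suc n))) (*-monoʳ-≤ 2 (n≤2^⌈log2⌉n (suc ⌈ n /2⌉) _))

n<2^[1+⌊log2⌋n] : ∀ n (rec : Acc _<_ n) → n < 2 ^ suc (⌊log2⌋ n rec)
n<2^[1+⌊log2⌋n] 0 _ = s≤s z≤n
n<2^[1+⌊log2⌋n] 1 _ = s≤s (s≤s z≤n)
n<2^[1+⌊log2⌋n] (suc (suc n)) (acc rs) =
  ≤-trans (n<2*suc⌊n/2⌋ (suc (suc n))) (*-monoʳ-≤ 2 (n<2^[1+⌊log2⌋n] (suc ⌊ n /2⌋) _))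

⌈log₂⌉≤⇒≤2^ : ∀ {n k} → ⌈log₂ n ⌉ ≤ k → n ≤ 2 ^ k
⌈log₂⌉≤⇒≤2^ {n} le = ≤-trans (n≤2^⌈log2⌉n n (<-wellFounded n)) (^-monoʳ-≤ 2 le)

⌊log₂⌋<⇒<2^ : ∀ {n k} → ⌊log₂ n ⌋ < k → n < 2 ^ k
⌊log₂⌋<⇒<2^ {n} lt = <-≤-trans (n<2^[1+⌊log2⌋n] n (<-wellFounded n)) (^-monoʳ-≤ 2 lt)

Collision : ∀ {a b r} {A : Set a} {B : Set b} → (B → B → Set r) → (A → B) → Set _
Collision _≈_ f = ∃₂ λ x y → x ≢ y × f x ≈ f y

collision⊎injective : ∀ {m n} (f : Fin m → Fin n) → Collision _≡_ f ⊎ Injective _≡_ _≡_ f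
collision⊎injective f with any? (λ i → any? λ j → ¬? (i ≟ j) ×-dec (f i ≟ f j))
... | yes collision = inj₁ collision
... | no noCollision = inj₂ λ {i} {j} fi≡fj →
  decidable-stable (i ≟ j) λ i≢j → noCollision (i , j , i≢j , fi≡fj)

injective⇒surjective : ∀ {m n} {f : Fin m → Fin n} → n ≤ m → Injective _≡_ _≡_ f →
  ∀ y → ∃ λ i → f i ≡ y
injective⇒surjective {m} {suc n} {f} n<m f-inj y with any? (λ i → f i ≟ y)
... | yes hit = hit
... | no miss = contradiction (λ {i} {j} → g-inj {i} {j}) (<⇒notInjective n<m)
  where
  y≢f : ∀ i → y ≢ f i
  y≢f i y≡fi = miss (i , ≡.sym y≡fi)
  g : Fin m → Fin n
  g i = punchOut (y≢f i)
  g-inj : Injective _≡_ _≡_ g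
  g-inj {i} {j} eq = f-inj (punchOut-injective (y≢f i) (y≢f j) eq)

open Inverse 2↔Bool using (to; from; strictlyInverseˡ; strictlyInverseʳ)

toBits : ∀ k → Fin (2 ^ k) → Vec Bool k
toBits zero    _ = []
toBits (suc k) i = to (proj₁ r) ∷ toBits k (proj₂ r)
  where r = remQuot (2 ^ k) i

fromBits : ∀ {k} → Vec Bool k → Fin (2 ^ k)
fromBits []      = zero
fromBits (b ∷ u) = combine (from b) (fromBits u)

fromBits-toBits : ∀ k i → fromBits (toBits k i) ≡ i
fromBits-toBits zero    zero = refl
fromBits-toBits (suc k) i = ≡.trans
  (cong₂ combine (strictlyInverseʳ (proj₁ r)) (fromBits-toBits k (proj₂ r)))
  (combine-remQuot (2 ^ k) i)
  where r = remQuot (2 ^ k) i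

toBits-fromBits : ∀ {k} (u : Vec Bool k) → toBits k (fromBits u) ≡ u
toBits-fromBits []      = refl
toBits-fromBits {suc k} (b ∷ u) = ≡.trans
  (cong (λ r → to (proj₁ r) ∷ toBits k (proj₂ r)) (remQuot-combine (from b) (fromBits u)))
  (cong₂ _∷_ (strictlyInverseˡ b) (toBits-fromBits u))

toBits-injective : ∀ k {i j} → toBits k i ≡ toBits k j → i ≡ j
toBits-injective k {i} {j} eq =
  ≡.trans (≡.sym (fromBits-toBits k i)) (≡.trans (cong fromBits eq) (fromBits-toBits k j))

fromBits-injective : ∀ {k} {u u' : Vec Bool k} → fromBits u ≡ fromBits u' → u ≡ u'
fromBits-injective {k} {u} {u'} eq =
  ≡.trans (≡.sym (toBits-fromBits u)) (≡.trans (cong (toBits k) eq) (toBits-fromBits u'))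

weight : ∀ {k} → Vec Bool k → ℕ
weight []          = 0
weight (false ∷ u) = weight u
weight (true ∷ u)  = suc (weight u)

parity : ∀ {k} → Vec Bool k → Bool
parity []      = false
parity (b ∷ u) = b xor parity u

weight-≤ : ∀ {k} (u : Vec Bool k) → weight u ≤ k
weight-≤ []          = z≤n
weight-≤ (false ∷ u) = m≤n⇒m≤1+n (weight-≤ u)
weight-≤ (true ∷ u)  = s≤s (weight-≤ u)

weight-< : ∀ {k} (u : Vec Bool k) → u ≢ replicate k true → weight u < k
weight-< []          u≢1 = ⊥-elim (u≢1 refl)
weight-< (false ∷ u) _   = s≤s (weight-≤ u)
weight-< (true ∷ u)  u≢1 = s≤s (weight-< u (u≢1 ∘ cong (true ∷_)))

weight-replicate : ∀ k → weight (replicate k true) ≡ k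
weight-replicate zero    = refl
weight-replicate (suc k) = cong suc (weight-replicate k)

weight-insertAt : ∀ {k} (u : Vec Bool k) p b → weight (insertAt u p b) ≡ weight (b ∷ u)
weight-insertAt u           zero    b     = refl
weight-insertAt (false ∷ u) (suc p) false = weight-insertAt u p false
weight-insertAt (false ∷ u) (suc p) true  = weight-insertAt u p true
weight-insertAt (true ∷ u)  (suc p) false = cong suc (weight-insertAt u p false)
weight-insertAt (true ∷ u)  (suc p) true  = cong suc (weight-insertAt u p true)

weight-xor-pos : ∀ {k} (u u' : Vec Bool k) → u ≢ u' → 0 < weight (zipWith _xor_ u u')
weight-xor-pos []          []           u≢u' = ⊥-elim (u≢u' refl)
weight-xor-pos (false ∷ u) (true ∷ u')  _    = s≤s z≤n
weight-xor-pos (true ∷ u)  (false ∷ u') _    = s≤s z≤n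
weight-xor-pos (false ∷ u) (false ∷ u') u≢u' = weight-xor-pos u u' (u≢u' ∘ cong (false ∷_))
weight-xor-pos (true ∷ u)  (true ∷ u')  u≢u' = weight-xor-pos u u' (u≢u' ∘ cong (true ∷_))

parity-xor : ∀ {k} (u u' : Vec Bool k) → parity (zipWith _xor_ u u') ≡ parity u xor parity u'
parity-xor []      []        = refl
parity-xor (a ∷ u) (a' ∷ u') =
  ≡.trans (cong ((a xor a') xor_) (parity-xor u u')) (xor-interchange a a' (parity u) (parity u'))

even-weight : ∀ {k} (u : Vec Bool k) → parity u ≡ false → 2 ∣ weight u
odd-weight  : ∀ {k} (u : Vec Bool k) → parity u ≡ true → 2 ∣ suc (weight u)

even-weight []          _    = divides 0 refl
even-weight (false ∷ u) even = even-weight u even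
even-weight (true ∷ u)  even = odd-weight u (not-injective even)

odd-weight (false ∷ u) odd = odd-weight u odd
odd-weight (true ∷ u)  odd = ∣m∣n⇒∣m+n ∣-refl (even-weight u (not-injective odd))

even-xor : ∀ {k} (u u' : Vec Bool k) → parity u ≡ parity u' → 2 ∣ weight (zipWith _xor_ u u')
even-xor u u' same = even-weight (zipWith _xor_ u u') (begin
  parity (zipWith _xor_ u u') ≡⟨ parity-xor u u' ⟩
  parity u xor parity u'      ≡⟨ cong (_xor parity u') same ⟩
  parity u' xor parity u'     ≡⟨ xor-same (parity u') ⟩
  false                       ∎)
  where open ≡.≡-Reasoning

odd-replicate : ∀ k → parity (replicate (suc k) true) ≡ true → 2 ∣ k
odd-replicate k odd = ∣m+n∣m⇒∣n (subst (2 ∣_) (cong suc (weight-replicate (suc k))) 2∣2+k) ∣-refl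
  where 2∣2+k = odd-weight (replicate (suc k) true) odd

insertAt-true : ∀ {j} (u : Vec Bool (suc j)) → u ≢ replicate (suc j) false →
  ∃₂ λ q u' → u ≡ insertAt u' q true
insertAt-true         (true ∷ u)  _    = zero , u , refl
insertAt-true {zero}  (false ∷ []) u≢0 = ⊥-elim (u≢0 refl)
insertAt-true {suc j} (false ∷ u) u≢0 with q , u' , u≡ ← insertAt-true u (u≢0 ∘ cong (false ∷_)) =
  suc q , false ∷ u' , cong (false ∷_) u≡

evenVec oddVec : ∀ {k} → Vec Bool k → Vec Bool (suc k)
evenVec u = parity u ∷ u
oddVec  u = not (parity u) ∷ u

parity-evenVec : ∀ {k} (u : Vec Bool k) → parity (evenVec u) ≡ false
parity-evenVec u = xor-same (parity u)

parity-oddVec : ∀ {k} (u : Vec Bool k) → parity (oddVec u) ≡ true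
parity-oddVec u with parity u
... | false = refl
... | true  = refl

evenVec-xor : ∀ {k} (u u' : Vec Bool k) →
  evenVec (zipWith _xor_ u u') ≡ zipWith _xor_ (evenVec u) (evenVec u')
evenVec-xor u u' = cong (_∷ zipWith _xor_ u u') (parity-xor u u')

evenVec-injective : ∀ {k} {u u' : Vec Bool k} → evenVec u ≡ evenVec u' → u ≡ u'
evenVec-injective refl = refl

oddVec-injective : ∀ {k} {u u' : Vec Bool k} → oddVec u ≡ oddVec u' → u ≡ u'
oddVec-injective refl = refl

-- A selection weights each term of a vector by 0 (nothing), +1 or -1 (just a sign).
support : ∀ {k} → Vec (Maybe Sign) k → Vec Bool k
support = map is-just

size : ∀ {k} → Vec (Maybe Sign) k → ℕ
size = weight ∘ support

positive : Bool → Maybe Sign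
positive true  = just Sign.+
positive false = nothing

select : ∀ {k} → Vec Bool k → Vec (Maybe Sign) k
select = map positive

compare : Bool → Bool → Maybe Sign
compare true  false = just Sign.+
compare false true  = just Sign.-
compare _     _     = nothing

difference : ∀ {k} → Vec Bool k → Vec Bool k → Vec (Maybe Sign) k
difference = zipWith compare

support-select : ∀ {k} (u : Vec Bool k) → support (select u) ≡ u
support-select []          = refl
support-select (false ∷ u) = cong (false ∷_) (support-select u)
support-select (true ∷ u)  = cong (true ∷_) (support-select u)

support-difference : ∀ {k} (u u' : Vec Bool k) → support (difference u u') ≡ zipWith _xor_ u u'
support-difference []          []           = refl
support-difference (false ∷ u) (false ∷ u') = cong (false ∷_) (support-difference u u')
support-difference (false ∷ u) (true ∷ u')  = cong (true ∷_) (support-difference u u')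
support-difference (true ∷ u)  (false ∷ u') = cong (true ∷_) (support-difference u u')
support-difference (true ∷ u)  (true ∷ u')  = cong (false ∷_) (support-difference u u')

size-insertAt : ∀ {k} (w : Vec (Maybe Sign) k) p x → size (insertAt w p x) ≡ size (x ∷ w)
size-insertAt w p x =
  ≡.trans (cong weight (map-insertAt is-just x w p)) (weight-insertAt (support w) p (is-just x))

ProperEven : ℕ → ℕ → Set
ProperEven k m = m < k × 2 ∣ m

module _ {c ℓ : Level} (G : AbelianGroup c ℓ) where
  open AbelianGroup G renaming (Carrier to C; refl to ≈-refl)
  open import Algebra.Properties.Group group using (∙-cancelˡ; identityˡ-unique)
  open import Algebra.Properties.CommutativeSemigroup commutativeSemigroup using (x∙yz≈y∙xz; interchange)
  open import Relation.Binary.Reasoning.Setoid setoid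

  term : Maybe Sign → C → C
  term nothing  _ = ε
  term (just s) g = signed G s g

  selectedSum : ∀ {k} → Vec C k → Vec (Maybe Sign) k → C
  selectedSum []      []      = ε
  selectedSum (g ∷ v) (x ∷ w) = term x g ∙ selectedSum v w

  subsetSum : ∀ {k} → Vec C k → Vec Bool k → C
  subsetSum v u = selectedSum v (select u)

  fullSum : ∀ {k} → Vec C k → C
  fullSum {k} v = subsetSum v (replicate k true)

  selectedSum-insertAt : ∀ {k} (v : Vec C k) w p g x →
    selectedSum (insertAt v p g) (insertAt w p x) ≈ term x g ∙ selectedSum v w
  selectedSum-insertAt v       w       zero    g x = ≈-refl
  selectedSum-insertAt (h ∷ v) (y ∷ w) (suc p) g x = begin
    term y h ∙ selectedSum (insertAt v p g) (insertAt w p x) ≈⟨ ∙-congˡ (selectedSum-insertAt v w p g x) ⟩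
    term y h ∙ (term x g ∙ selectedSum v w)                  ≈⟨ x∙yz≈y∙xz _ _ _ ⟩
    term x g ∙ (term y h ∙ selectedSum v w)                  ∎

  subsetSum-insertAt : ∀ {k} (v : Vec C k) u p g b →
    subsetSum (insertAt v p g) (insertAt u p b) ≈ term (positive b) g ∙ subsetSum v u
  subsetSum-insertAt v u p g b = trans
    (reflexive (cong (selectedSum (insertAt v p g)) (map-insertAt positive b u p)))
    (selectedSum-insertAt v (select u) p g (positive b))

  fullSum-removeAt : ∀ {k} (v : Vec C (suc k)) p → fullSum v ≈ lookup v p ∙ fullSum (removeAt v p)
  fullSum-removeAt {k} v p = begin
    fullSum v                                         ≡⟨ cong fullSum (≡.sym (insertAt-removeAt v p)) ⟩
    subsetSum v' (replicate (suc k) true)             ≡⟨ cong (subsetSum v') (replicate-insertAt p) ⟩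
    subsetSum v' (insertAt (replicate k true) p true) ≈⟨ subsetSum-insertAt (removeAt v p) _ p _ true ⟩
    lookup v p ∙ fullSum (removeAt v p)               ∎
    where
    v' = insertAt (removeAt v p) p (lookup v p)
    replicate-insertAt : ∀ {j} (q : Fin (suc j)) →
      replicate (suc j) true ≡ insertAt (replicate j true) q true
    replicate-insertAt         zero    = refl
    replicate-insertAt {suc j} (suc q) = cong (true ∷_) (replicate-insertAt q)

  double≈fullSum : ∀ {k} (v : Vec C (suc k)) p → lookup v p ≈ fullSum (removeAt v p) →
    lookup v p ∙ lookup v p ≈ fullSum v
  double≈fullSum v p y≈ = trans (∙-congˡ y≈) (sym (fullSum-removeAt v p))

  subsetSum-zeros : ∀ {k} (v : Vec C k) → subsetSum v (replicate k false) ≈ ε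
  subsetSum-zeros []      = ≈-refl
  subsetSum-zeros (g ∷ v) = trans (identityˡ _) (subsetSum-zeros v)

  term-compare : ∀ g a b → term (compare a b) g ∙ term (positive b) g ≈ term (positive a) g
  term-compare g false false = identityˡ ε
  term-compare g false true  = inverseˡ g
  term-compare g true  false = identityʳ g
  term-compare g true  true  = identityˡ g

  selectedSum-difference : ∀ {k} (v : Vec C k) u u' →
    selectedSum v (difference u u') ∙ subsetSum v u' ≈ subsetSum v u
  selectedSum-difference []      []      []        = identityˡ ε
  selectedSum-difference (g ∷ v) (a ∷ u) (b ∷ u') = trans
    (interchange _ _ _ _)
    (∙-cong (term-compare g a b) (selectedSum-difference v u u'))

  term-xor : ∀ g → g ∙ g ≈ ε → ∀ a b →
    term (positive (a xor b)) g ≈ term (positive a) g ∙ term (positive b) g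
  term-xor g g²≈ε false false = sym (identityˡ ε)
  term-xor g g²≈ε false true  = sym (identityˡ g)
  term-xor g g²≈ε true  false = sym (identityʳ g)
  term-xor g g²≈ε true  true  = sym g²≈ε

  subsetSum-xor : ∀ {k} (v : Vec C k) → (∀ q → lookup v q ∙ lookup v q ≈ ε) →
    ∀ u u' → subsetSum v (zipWith _xor_ u u') ≈ subsetSum v u ∙ subsetSum v u'
  subsetSum-xor []      _       []      []        = sym (identityˡ ε)
  subsetSum-xor (g ∷ v) torsion (a ∷ u) (b ∷ u') = trans
    (∙-cong (term-xor g (torsion zero) a b) (subsetSum-xor v (torsion ∘ suc) u u'))
    (interchange _ _ _ _)

  record ZeroSumSelection {k} (v : Vec C k) (P : ℕ → Set) : Set ℓ where
    constructor zeroSum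
    field
      weights  : Vec (Maybe Sign) k
      sum≈ε    : selectedSum v weights ≈ ε
      nonempty : 0 < size weights
      size-ok  : P (size weights)

  weaken : ∀ {k} {v : Vec C k} {P Q : ℕ → Set} → (∀ {m} → m ≤ k → P m → Q m) →
    ZeroSumSelection v P → ZeroSumSelection v Q
  weaken P⇒Q (zeroSum w sum≈ε nonempty Pw) = zeroSum w sum≈ε nonempty (P⇒Q (weight-≤ (support w)) Pw)

  insertAt-unselected : ∀ {k} {v : Vec C k} {P} p g →
    ZeroSumSelection v P → ZeroSumSelection (insertAt v p g) P
  insertAt-unselected {v = v} {P} p g (zeroSum w sum≈ε nonempty Pw) = zeroSum (insertAt w p nothing)
    (trans (selectedSum-insertAt v w p g nothing) (trans (identityˡ _) sum≈ε))
    (subst (0 <_) (≡.sym size≡) nonempty)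
    (subst P (≡.sym size≡) Pw)
    where size≡ = size-insertAt w p nothing

  reassemble : ∀ {k} {P} (v : Vec C (suc k)) p →
    ZeroSumSelection (insertAt (removeAt v p) p (lookup v p)) P → ZeroSumSelection v P
  reassemble {P = P} v p = subst (λ v' → ZeroSumSelection v' P) (insertAt-removeAt v p)

  collision⇒zeroSum : ∀ {k} (v : Vec C k) {u u'} → u ≢ u' → subsetSum v u ≈ subsetSum v u' →
    ZeroSumSelection v (_≡ weight (zipWith _xor_ u u'))
  collision⇒zeroSum v {u} {u'} u≢u' eq = zeroSum (difference u u')
    (identityˡ-unique _ _ (trans (selectedSum-difference v u u') eq))
    (subst (0 <_) (≡.sym size≡) (weight-xor-pos u u' u≢u'))
    size≡
    where size≡ = cong weight (support-difference u u')

  represented⇒zeroSum : ∀ {k} (v : Vec C k) p {y u} → y ≈ subsetSum v u →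
    ZeroSumSelection (insertAt v p y) (_≡ suc (weight u))
  represented⇒zeroSum v p {y} {u} y≈ = zeroSum w
    (begin
      selectedSum (insertAt v p y) w ≈⟨ selectedSum-insertAt v (select u) p y (just Sign.-) ⟩
      y ⁻¹ ∙ subsetSum v u           ≈⟨ ∙-congˡ (sym y≈) ⟩
      y ⁻¹ ∙ y                       ≈⟨ inverseˡ y ⟩
      ε                              ∎)
    (subst (0 <_) (≡.sym size≡) (s≤s z≤n))
    size≡
    where
    w = insertAt (select u) p (just Sign.-)
    size≡ : size w ≡ suc (weight u)
    size≡ = ≡.trans (size-insertAt (select u) p _) (cong (suc ∘ weight) (support-select u))

  toSubsequence : (S : List C) (w : Vec (Maybe Sign) (length S)) →
    ∃ λ T → T ⊆ S × length T ≡ size w × ∃ λ ws → weightedSum G T ws ≈ selectedSum (fromList S) w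
  toSubsequence []      []            = [] , [] , refl , [] , ≈-refl
  toSubsequence (g ∷ S) (nothing ∷ w) with T , T⊆S , len , ws , eq ← toSubsequence S w =
    T , g ∷ʳ T⊆S , len , ws , trans eq (sym (identityˡ _))
  toSubsequence (g ∷ S) (just s ∷ w)  with T , T⊆S , len , ws , eq ← toSubsequence S w =
    g ∷ T , refl ∷ T⊆S , cong suc len , s ∷ ws , ∙-congˡ eq

  zeroSumSubsequence : ∀ {P} (S : List C) → ZeroSumSelection (fromList S) P →
    ∃ λ T → T ⊆ S × 0 < length T × P (length T) × PMZeroSum G T
  zeroSumSubsequence {P} S (zeroSum w zero-sum nonempty Pw) with T , T⊆S , len , ws , eq ← toSubsequence S w =
    T , T⊆S , subst (0 <_) (≡.sym len) nonempty , subst P (≡.sym len) Pw , ws , trans eq zero-sum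

  evenCollision⇒zeroSum : ∀ {j k} (v : Vec C k) (F : Vec Bool j → Vec Bool k) →
    (∀ {a b} → F a ≡ F b → a ≡ b) → ∀ {b} → (∀ a → parity (F a) ≡ b) →
    Collision _≈_ (subsetSum v ∘ F) → ZeroSumSelection v (2 ∣_)
  evenCollision⇒zeroSum v F F-inj F-parity (a , a' , a≢a' , eq) =
    weaken (λ _ m≡ → subst (2 ∣_) (≡.sym m≡) (even-xor (F a) (F a') same-parity))
      (collision⇒zeroSum v (a≢a' ∘ F-inj) eq)
    where same-parity = ≡.trans (F-parity a) (≡.sym (F-parity a'))

  cancel-double : ∀ {k} (v : Vec C k) p {y c u} → y ∙ y ≈ c →
    subsetSum (insertAt v p y) (insertAt u p true) ≈ c → y ≈ subsetSum v u
  cancel-double v p {y} {u = u} y∙y≈c sum≈c =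
    ∙-cancelˡ y _ _ (trans y∙y≈c (trans (sym sum≈c) (subsetSum-insertAt v u p y true)))

  double≈sum⇒zeroSum : ∀ {k} (v : Vec C (suc k)) q {c u} → lookup v q ∙ lookup v q ≈ c →
    subsetSum v (insertAt u q true) ≈ c → ZeroSumSelection v (_≡ suc (weight u))
  double≈sum⇒zeroSum v q {c} {u} double sum≈c =
    reassemble v q (represented⇒zeroSum others q (cancel-double others q double sum'≈c))
    where
    others = removeAt v q
    sum'≈c : subsetSum (insertAt others q (lookup v q)) (insertAt u q true) ≈ c
    sum'≈c = trans (reflexive (cong (λ v' → subsetSum v' (insertAt u q true)) (insertAt-removeAt v q)))
                   sum≈c

  torsion⊎zeroSum : ∀ {k} (v : Vec C k) {c u} →
    (∀ q → lookup v q ∙ lookup v q ≈ c) → subsetSum v u ≈ c →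
    (∀ q → lookup v q ∙ lookup v q ≈ ε) ⊎ ZeroSumSelection v (_≡ weight u)
  torsion⊎zeroSum []  _ _ = inj₁ λ ()
  torsion⊎zeroSum {suc k} v {c} {u} doubles sum≈c with ≡-dec Bool._≟_ u (replicate (suc k) false)
  ... | yes refl = inj₁ λ q → trans (doubles q) (trans (sym sum≈c) (subsetSum-zeros v))
  ... | no u≢0 with insertAt-true u u≢0
  ...   | q , u' , refl = inj₂ (weaken (λ _ m≡ → ≡.trans m≡ (≡.sym (weight-insertAt u' q true)))
                                   (double≈sum⇒zeroSum v q (doubles q) sum≈c))

  nonemptySubsequence : ∀ {P} S → ZeroSumSelection (fromList S) P → HasNonemptyPMZS G S
  nonemptySubsequence S zs with T , T⊆S , nonempty , _ , zero-sum ← zeroSumSubsequence S zs =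
    T , T⊆S , nonempty , zero-sum

  evenSubsequence : ∀ S → ZeroSumSelection (fromList S) (2 ∣_) → HasNonemptyEvenPMZS G S
  evenSubsequence S zs with T , T⊆S , nonempty , even , zero-sum ← zeroSumSubsequence S zs =
    T , T⊆S , nonempty , even , zero-sum

  properSubsequence : ∀ S → ZeroSumSelection (fromList S) (_< length S) → HasProperNonemptyPMZS G S
  properSubsequence S zs with T , T⊆S , nonempty , proper , zero-sum ← zeroSumSubsequence S zs =
    T , T⊆S , nonempty , proper , zero-sum

  properEvenSubsequence : ∀ S → ZeroSumSelection (fromList S) (ProperEven (length S)) →
    HasProperNonemptyEvenPMZS G S
  properEvenSubsequence S zs with T , T⊆S , nonempty , (proper , even) , zero-sum ← zeroSumSubsequence S zs =
    T , T⊆S , nonempty , proper , even , zero-sum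

  Bijective : ∀ {k} → (Vec Bool k → C) → Set (c ⊔ ℓ)
  Bijective F = (∀ u u' → F u ≈ F u' → u ≡ u') × (∀ x → ∃ λ u → F u ≈ x)

  subsetSum-iso : ∀ {j k} (v : Vec C k) (E : Vec Bool j → Vec Bool k) →
    (∀ a b → E (zipWith _xor_ a b) ≡ zipWith _xor_ (E a) (E b)) →
    (∀ q → lookup v q ∙ lookup v q ≈ ε) → Bijective (subsetSum v ∘ E) → Z₂^-Iso G j
  subsetSum-iso v E E-xor torsion (inj , surj) = record
    { φ      = subsetSum v ∘ E
    ; φ-hom  = λ a b → trans (reflexive (cong (subsetSum v) (E-xor a b))) (subsetSum-xor v torsion (E a) (E b))
    ; φ-inj  = inj
    ; φ-surj = surj
    }

  module Counting {n} (order : HasOrder G n) where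
    open HasOrder order

    index : C → Fin n
    index x = proj₁ (enum-surj x)

    enum-index : ∀ x → enum (index x) ≈ x
    enum-index x = proj₂ (enum-surj x)

    index-injective : ∀ {x y} → index x ≡ index y → x ≈ y
    index-injective {x} {y} eq = trans (sym (enum-index x)) (trans (reflexive (cong enum eq)) (enum-index y))

    index-cong : ∀ {x y} → x ≈ y → index x ≡ index y
    index-cong {x} {y} x≈y = enum-inj _ _ (trans (enum-index x) (trans x≈y (sym (enum-index y))))

    module _ {k} (F : Vec Bool k → C) where
      indexed : Fin (2 ^ k) → Fin n
      indexed = index ∘ F ∘ toBits k

      indexed-fromBits : ∀ u → indexed (fromBits u) ≡ index (F u)
      indexed-fromBits u = cong (index ∘ F) (toBits-fromBits u)

      lift-collision : Collision _≡_ indexed → Collision _≈_ F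
      lift-collision (i , j , i≢j , eq) =
        toBits k i , toBits k j ,
        i≢j ∘ toBits-injective k ,
        index-injective eq

      collision⊎bijective : n ≤ 2 ^ k → Collision _≈_ F ⊎ Bijective F
      collision⊎bijective n≤2^k with collision⊎injective indexed
      ... | inj₁ collision   = inj₁ (lift-collision collision)
      ... | inj₂ indexed-inj = inj₂ (F-inj , F-surj)
        where
        F-inj : ∀ u u' → F u ≈ F u' → u ≡ u'
        F-inj u u' eq = fromBits-injective (indexed-inj
          (≡.trans (indexed-fromBits u) (≡.trans (index-cong eq) (≡.sym (indexed-fromBits u')))))
        F-surj : ∀ x → ∃ λ u → F u ≈ x
        F-surj x with i , eq ← injective⇒surjective n≤2^k (λ {i} {j} → indexed-inj {i} {j}) (index x) =
          toBits k i , index-injective eq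

      collision : n < 2 ^ k → Collision _≈_ F
      collision n<2^k with collision⊎injective indexed
      ... | inj₁ collision   = lift-collision collision
      ... | inj₂ indexed-inj = contradiction (λ {i} {j} → indexed-inj {i} {j}) (<⇒notInjective n<2^k)

    proper⊎sumOfOthers : ∀ {k} → n ≤ 2 ^ k → (L : Vec C k) → ∀ p y →
      ZeroSumSelection (insertAt L p y) (_< suc k) ⊎ (Bijective (subsetSum L) × y ≈ fullSum L)
    proper⊎sumOfOthers {k} n≤2^k L p y with collision⊎bijective (subsetSum L) n≤2^k
    ... | inj₁ (u , u' , u≢u' , eq) =
      inj₁ (insertAt-unselected p y (weaken (λ m≤k _ → s≤s m≤k) (collision⇒zeroSum L u≢u' eq)))
    ... | inj₂ bij@(_ , surj) with surj y
    ...   | u , σu≈y with ≡-dec Bool._≟_ u (replicate k true)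
    ...     | yes refl = inj₂ (bij , sym σu≈y)
    ...     | no u≢1 = inj₁ (weaken (λ _ m≡ → subst (_< suc k) (≡.sym m≡) (s≤s (weight-< u u≢1)))
                                    (represented⇒zeroSum L p (sym σu≈y)))

    properZeroSum : ∀ {k} → n ≤ 2 ^ k → (v : Vec C (suc k)) → ¬ IsElemAb2 G →
      ZeroSumSelection v (_< suc k)
    properZeroSum {k} n≤2^k (g ∷ T) notElem =
      [ id , fromSumsOfOthers ]′ (sequence (Sumₗ.applicative _ (c ⊔ ℓ)) atPosition)
      where
      v = g ∷ T
      SumOfOthers : Fin (suc k) → Set (c ⊔ ℓ)
      SumOfOthers p = Bijective (subsetSum (removeAt v p)) × lookup v p ≈ fullSum (removeAt v p)
      atPosition : ∀ p → ZeroSumSelection v (_< suc k) ⊎ SumOfOthers p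
      atPosition p = map₁ (reassemble v p) (proper⊎sumOfOthers n≤2^k (removeAt v p) p (lookup v p))
      fromSumsOfOthers : (∀ p → SumOfOthers p) → ZeroSumSelection v (_< suc k)
      fromSumsOfOthers sumOfOthers =
        [ ⊥-elim ∘ notElem ∘ (k ,_) ∘ isomorphism , lift ]′ (torsion⊎zeroSum T doubles total≈)
        where
        T-bijective : Bijective (subsetSum T)
        T-bijective = proj₁ (sumOfOthers zero)
        doubles : ∀ q → lookup T q ∙ lookup T q ≈ fullSum v
        doubles q = double≈fullSum v (suc q) (proj₂ (sumOfOthers (suc q)))
        total≈ : subsetSum T (proj₁ (proj₂ T-bijective (fullSum v))) ≈ fullSum v
        total≈ = proj₂ (proj₂ T-bijective (fullSum v))
        isomorphism : (∀ q → lookup T q ∙ lookup T q ≈ ε) → Z₂^-Iso G k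
        isomorphism torsion = subsetSum-iso T id (λ _ _ → refl) torsion T-bijective
        lift : ∀ {P} → ZeroSumSelection T P → ZeroSumSelection v (_< suc k)
        lift = insertAt-unselected zero g ∘ weaken (λ m≤k _ → s≤s m≤k)

    properEven⊎sumOfOthers : ∀ {k} → n ≤ 2 ^ k → (L : Vec C (suc k)) → ∀ p y →
      ZeroSumSelection (insertAt L p y) (ProperEven (suc (suc k))) ⊎
      (Bijective (subsetSum L ∘ evenVec) × y ≈ fullSum L × 2 ∣ k)
    properEven⊎sumOfOthers {k} n≤2^k L p y
      with collision⊎bijective (subsetSum L ∘ evenVec) n≤2^k
         | collision⊎bijective (subsetSum L ∘ oddVec) n≤2^k
    ... | inj₁ evenCollision | _ =
      inj₁ (insertAt-unselected p y (weaken (λ m≤ even → s≤s m≤ , even)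
        (evenCollision⇒zeroSum L evenVec evenVec-injective parity-evenVec evenCollision)))
    ... | inj₂ _ | inj₁ oddCollision =
      inj₁ (insertAt-unselected p y (weaken (λ m≤ even → s≤s m≤ , even)
        (evenCollision⇒zeroSum L oddVec oddVec-injective parity-oddVec oddCollision)))
    ... | inj₂ bij | inj₂ (_ , oddSurj) with oddSurj y
    ...   | u , σ≈y with ≡-dec Bool._≟_ (oddVec u) (replicate (suc k) true)
    ...     | yes odd≡1 = inj₂ (bij , trans (sym σ≈y) (reflexive (cong (subsetSum L) odd≡1)) ,
                              odd-replicate k (≡.trans (cong parity (≡.sym odd≡1)) (parity-oddVec u)))
    ...     | no odd≢1 = inj₁ (weaken (λ _ m≡ → subst (ProperEven _) (≡.sym m≡)
                                        (s≤s (weight-< (oddVec u) odd≢1) , odd-weight (oddVec u) (parity-oddVec u)))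
                                    (represented⇒zeroSum L p (sym σ≈y)))

    properEvenZeroSum : ∀ {k} → n ≤ 2 ^ k → (v : Vec C (suc (suc k))) → ¬ IsElemAb2EvenRank G →
      ZeroSumSelection v (ProperEven (suc (suc k)))
    properEvenZeroSum {k} n≤2^k (g ∷ T) notElem =
      [ id , fromSumsOfOthers ]′ (sequence (Sumₗ.applicative _ (c ⊔ ℓ)) atPosition)
      where
      v = g ∷ T
      SumOfOthers : Fin (suc (suc k)) → Set (c ⊔ ℓ)
      SumOfOthers p =
        Bijective (subsetSum (removeAt v p) ∘ evenVec) × lookup v p ≈ fullSum (removeAt v p) × 2 ∣ k
      atPosition : ∀ p → ZeroSumSelection v (ProperEven (suc (suc k))) ⊎ SumOfOthers p
      atPosition p = map₁ (reassemble v p) (properEven⊎sumOfOthers n≤2^k (removeAt v p) p (lookup v p))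
      fromSumsOfOthers : (∀ p → SumOfOthers p) → ZeroSumSelection v (ProperEven (suc (suc k)))
      fromSumsOfOthers sumOfOthers =
        [ ⊥-elim ∘ notElem ∘ (k ,_) ∘ (even-rank ,_) ∘ isomorphism , lift ]′
          (torsion⊎zeroSum T doubles total≈)
        where
        T-bijective : Bijective (subsetSum T ∘ evenVec)
        T-bijective = proj₁ (sumOfOthers zero)
        even-rank : 2 ∣ k
        even-rank = proj₂ (proj₂ (sumOfOthers zero))
        doubles : ∀ q → lookup T q ∙ lookup T q ≈ fullSum v
        doubles q = double≈fullSum v (suc q) (proj₁ (proj₂ (sumOfOthers (suc q))))
        u : Vec Bool k
        u = proj₁ (proj₂ T-bijective (fullSum v))
        total≈ : subsetSum T (evenVec u) ≈ fullSum v
        total≈ = proj₂ (proj₂ T-bijective (fullSum v))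
        isomorphism : (∀ q → lookup T q ∙ lookup T q ≈ ε) → Z₂^-Iso G k
        isomorphism torsion = subsetSum-iso T evenVec evenVec-xor torsion T-bijective
        lift : ZeroSumSelection T (_≡ weight (evenVec u)) → ZeroSumSelection v (ProperEven (suc (suc k)))
        lift = insertAt-unselected zero g ∘ weaken λ m≤k m≡ →
          s≤s m≤k , subst (2 ∣_) (≡.sym m≡) (even-weight (evenVec u) (parity-evenVec u))

    hasProperNonemptyPMZS : ∀ S → 1 + ⌈log₂ n ⌉ ≤ length S → ¬ IsElemAb2 G →
      HasProperNonemptyPMZS G S
    hasProperNonemptyPMZS (g ∷ S) (s≤s long) notElem =
      properSubsequence (g ∷ S) (properZeroSum (⌈log₂⌉≤⇒≤2^ long) (fromList (g ∷ S)) notElem)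

    hasProperNonemptyEvenPMZS : ∀ S → 2 + ⌈log₂ n ⌉ ≤ length S → ¬ IsElemAb2EvenRank G →
      HasProperNonemptyEvenPMZS G S
    hasProperNonemptyEvenPMZS (g ∷ g' ∷ S) (s≤s (s≤s long)) notElem =
      properEvenSubsequence (g ∷ g' ∷ S)
        (properEvenZeroSum (⌈log₂⌉≤⇒≤2^ long) (fromList (g ∷ g' ∷ S)) notElem)

    hasNonemptyPMZS : ∀ S → ⌊log₂ n ⌋ < length S → HasNonemptyPMZS G S
    hasNonemptyPMZS S long
      with u , u' , u≢u' , eq ← collision (subsetSum (fromList S)) (⌊log₂⌋<⇒<2^ long) =
      nonemptySubsequence S (collision⇒zeroSum (fromList S) u≢u' eq)

    hasNonemptyEvenPMZS : ∀ S → 1 + ⌊log₂ n ⌋ < length S → HasNonemptyEvenPMZS G S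
    hasNonemptyEvenPMZS (g ∷ S) (s≤s long) = evenSubsequence (g ∷ S)
      (evenCollision⇒zeroSum (fromList (g ∷ S)) evenVec evenVec-injective parity-evenVec
        (collision (subsetSum (fromList (g ∷ S)) ∘ evenVec) (⌊log₂⌋<⇒<2^ long)))

theorem4p1 : {c ℓ : Level} (G : AbelianGroup c ℓ) (n : ℕ) → HasOrder G n → 1 < n →
    (S : List (AbelianGroup.Carrier G)) →
      ((1 + ⌈log₂ n ⌉ ≤ length S → ¬ IsElemAb2 G → HasProperNonemptyPMZS G S)
      × (2 + ⌈log₂ n ⌉ ≤ length S → ¬ IsElemAb2EvenRank G → HasProperNonemptyEvenPMZS G S)
      × ((⌊log₂ n ⌋ < length S → HasNonemptyPMZS G S)
        × (1 + ⌊log₂ n ⌋ < length S → HasNonemptyEvenPMZS G S)))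
theorem4p1 G n order _ S =
  hasProperNonemptyPMZS S , hasProperNonemptyEvenPMZS S , hasNonemptyPMZS S , hasNonemptyEvenPMZS S
  where open Counting G order
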